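{- Let $n\ge 1$ and $0\le m\le \binom{n}{2}$. For finite collections (multisets) $P$ and $Q$ of graphs with $n$ vertices and $m$ edges, if $\Delta_1X_P=\Delta_1X_Q$ then $d_1X_P=d_1X_Q$.
   Context: All graphs are simple. For a graph $G$ with $n$ vertices and $m$ edges, the $1$-edge deck $ED_1(G)$ is the multiset of the graphs $G-e$, $e\in E(G)$; the modified $1$-deck $MD_1(G)$ is the multiset of graphs $G-e+f$ where $e\in E(G)$ and $f$ ranges over all non-edges of $G-e$ (including $f=e$). For a finite multiset $S$ of graphs, its characteristic vector $X_S$ is indexed by isomorphism classes of $n$-vertex graphs with the relevant number of edges, the entry at a class being the number of members of $S$ in that class. $d_1$ is the matrix with rows indexed by isomorphism classes of $n$-vertex $(m-1)$-edge graphs and columns by those of $n$-vertex $m$-edge graphs, with $(k,l)$ entry the number of members of $ED_1(G_l)$ isomorphic to $G_k$. $\Delta_1$ is the square matrix indexed by isomorphism classes of $n$-vertex $m$-edge graphs with $(k,l)$ entry the number of members of $MD_1(G_l)$ isomorphic to $G_k$. -}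

module Defs where

open import Data.Bool using (Bool; true; false; if_then_else_; _∧_; _∨_; not; T)
open import Data.Bool.Properties using (∧-comm; ∨-comm; ∧-zeroʳ) renaming (_≟_ to _≟ᵇ_)
open import Data.Nat using (ℕ; _+_; _*_)
open import Data.Fin using (Fin; _<_)
open import Data.Fin.Properties using (_≟_; _<?_; any?; all?)
open import Data.Product using (Σ; ∃; _×_; _,_; proj₁; proj₂)
open import Data.List using (List; []; _∷_; map; concatMap; filter; length; cartesianProduct; allFin)
open import Data.Nat.ListAction using (sum)
open import Data.List.Relation.Unary.All using (All)
open import Data.List.Relation.Unary.Any using (Any)
open import Data.List.Relation.Unary.AllPairs using (AllPairs)
open import Data.Vec.Functional using (Vector) renaming (_∷_ to _∷ᶠ_)
open import Relation.Nullary using (Dec; yes; no; ¬_)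
open import Relation.Nullary.Decidable using (⌊_⌋; _×-dec_)
open import Relation.Binary.PropositionalEquality using (_≡_; refl; sym; trans; cong; _≗_)

record Graph (n : ℕ) : Set where
  field
    adj    : Fin n → Fin n → Bool
    adj-sym    : ∀ i j → adj i j ≡ adj j i
    adj-irrefl : ∀ i → adj i i ≡ false
open Graph public

_==_ : ∀ {n} → Fin n → Fin n → Bool
x == y = ⌊ x ≟ y ⌋

==-sym : ∀ {n} (x y : Fin n) → (x == y) ≡ (y == x)
==-sym x y with x ≟ y | y ≟ x
... | yes _ | yes _ = refl
... | no _  | no _  = refl
... | yes p | no ¬q = Data.Empty.⊥-elim (¬q (sym p))
  where import Data.Empty
... | no ¬p | yes q = Data.Empty.⊥-elim (¬p (sym q))
  where import Data.Empty

==-refl : ∀ {n} (x : Fin n) → (x == x) ≡ true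
==-refl x with x ≟ x
... | yes _ = refl
... | no ¬p = Data.Empty.⊥-elim (¬p refl)
  where import Data.Empty

samePair : ∀ {n} → Fin n → Fin n → Fin n → Fin n → Bool
samePair x y i j = ((x == i) ∧ (y == j)) ∨ ((x == j) ∧ (y == i))

samePair-sym : ∀ {n} (x y i j : Fin n) → samePair x y i j ≡ samePair y x i j
samePair-sym x y i j
  rewrite ∧-comm (x == i) (y == j) | ∧-comm (x == j) (y == i)
  = ∨-comm (y == j ∧ x == i) (y == i ∧ x == j)

-- Set the status of the pair {i,j} (i ≠ j intended) to b; all other
-- adjacencies unchanged.  (The factor 'not (x == y)' only guarantees
-- looplessness; it is irrelevant when i ≠ j.)
setEdge : ∀ {n} → Graph n → Fin n × Fin n → Bool → Graph n
setEdge {n} G (i , j) b = record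
  { adj = A
  ; adj-sym = s
  ; adj-irrefl = r
  }
  where
  A : Fin n → Fin n → Bool
  A x y = if samePair x y i j ∧ not (x == y) then b else adj G x y
  s : ∀ x y → A x y ≡ A y x
  s x y rewrite samePair-sym x y i j | ==-sym x y | adj-sym G x y = refl
  r : ∀ x → A x x ≡ false
  r x rewrite ==-refl x | ∧-zeroʳ (samePair x x i j) = adj-irrefl G x

removeEdge : ∀ {n} → Graph n → Fin n × Fin n → Graph n
removeEdge G e = setEdge G e false

addEdge : ∀ {n} → Graph n → Fin n × Fin n → Graph n
addEdge G f = setEdge G f true

pairs : (n : ℕ) → List (Fin n × Fin n)
pairs n = filter (λ p → proj₁ p <? proj₂ p) (cartesianProduct (allFin n) (allFin n))

edges : ∀ {n} → Graph n → List (Fin n × Fin n)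
edges G = filter (λ p → adj G (proj₁ p) (proj₂ p) ≟ᵇ true) (pairs _)

nonEdges : ∀ {n} → Graph n → List (Fin n × Fin n)
nonEdges G = filter (λ p → adj G (proj₁ p) (proj₂ p) ≟ᵇ false) (pairs _)

edgeCount : ∀ {n} → Graph n → ℕ
edgeCount G = length (edges G)

HasEdges : ∀ {n} → ℕ → Graph n → Set
HasEdges m G = edgeCount G ≡ m

-- Decks (as lists = finite multisets)

ED1 : ∀ {n} → Graph n → List (Graph n)
ED1 G = map (removeEdge G) (edges G)

-- MD_1(G) = { G - e + f : e ∈ E(G), f a non-edge of G - e (f = e allowed) }
MD1 : ∀ {n} → Graph n → List (Graph n)
MD1 G = concatMap (λ e → map (addEdge (removeEdge G e)) (nonEdges (removeEdge G e))) (edges G)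

IsIso : ∀ {n} → Graph n → Graph n → (Fin n → Fin n) → (Fin n → Fin n) → Set
IsIso G H σ τ =
  (∀ i → τ (σ i) ≡ i) × (∀ i → σ (τ i) ≡ i) × (∀ i j → adj H (σ i) (σ j) ≡ adj G i j)

_≅_ : ∀ {n} → Graph n → Graph n → Set
G ≅ H = Σ (_ → _) λ σ → Σ (_ → _) λ τ → IsIso G H σ τ

∃fun? : ∀ {k m} (P : (Fin k → Fin m) → Set) →
        (∀ {f g} → f ≗ g → P f → P g) → (∀ f → Dec (P f)) →
        Dec (Σ (Fin k → Fin m) P)
∃fun? {Data.Nat.zero} P resp dec with dec (λ ())
... | yes p = yes (_ , p)
... | no ¬p = no λ { (f , pf) → ¬p (resp (λ ()) pf) }
∃fun? {Data.Nat.suc k} {m} P resp dec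
  with any? (λ a → ∃fun? {k} (λ g → P (a ∷ᶠ g)) (λ eq → resp (ext eq)) (λ g → dec _))
  where
  ext : ∀ {a} {f g : Fin k → Fin m} → f ≗ g → (a ∷ᶠ f) ≗ (a ∷ᶠ g)
  ext eq Fin.zero = refl
  ext eq (Fin.suc i) = eq i
... | yes (a , g , p) = yes (_ , p)
... | no ¬q = no λ { (f , pf) → ¬q (f Fin.zero , (λ i → f (Fin.suc i)) , resp η pf) }
  where
  η : ∀ {f : Fin (Data.Nat.suc k) → Fin m} → f ≗ (f Fin.zero ∷ᶠ (λ i → f (Fin.suc i)))
  η Fin.zero = refl
  η (Fin.suc i) = refl

IsIso? : ∀ {n} (G H : Graph n) σ τ → Dec (IsIso G H σ τ)
IsIso? G H σ τ =
  all? (λ i → τ (σ i) ≟ i) ×-dec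
  (all? (λ i → σ (τ i) ≟ i) ×-dec
   all? (λ i → all? (λ j → adj H (σ i) (σ j) ≟ᵇ adj G i j)))

_≅?_ : ∀ {n} (G H : Graph n) → Dec (G ≅ H)
G ≅? H = ∃fun? _ respσ (λ σ → ∃fun? _ respτ (IsIso? G H σ))
  where
  respτ : ∀ {σ τ τ'} → τ ≗ τ' → IsIso G H σ τ → IsIso G H σ τ'
  respτ {σ} eq (a , b , c) =
    (λ i → trans (sym (eq (σ i))) (a i)) , (λ i → trans (cong σ (sym (eq i))) (b i)) , c
  respσ : ∀ {σ σ'} → σ ≗ σ' → (Σ _ λ τ → IsIso G H σ τ) → Σ _ λ τ → IsIso G H σ' τ
  respσ {σ} {σ'} eq (τ , a , b , c) =
    τ , (λ i → trans (cong τ (sym (eq i))) (a i))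
      , (λ i → trans (sym (eq (τ i))) (b i))
      , (λ i j → trans (Relation.Binary.PropositionalEquality.cong₂ (adj H) (sym (eq i)) (sym (eq j))) (c i j))

-- Characteristic vectors and the matrices d_1, Δ_1.
-- Isomorphism classes are indexed by their representatives.

count : ∀ {n} → Graph n → List (Graph n) → ℕ
count G S = length (filter (λ H → H ≅? G) S)

X : ∀ {n} → List (Graph n) → Graph n → ℕ
X S G = count G S

-- (k,l) entries, with G_k = H, G_l = G
d1 : ∀ {n} → Graph n → Graph n → ℕ
d1 H G = count H (ED1 G)

Δ1 : ∀ {n} → Graph n → Graph n → ℕ
Δ1 H G = count H (MD1 G)

ClassReps : ∀ {n} → ℕ → List (Graph n) → Set
ClassReps m R =
  All (HasEdges m) R × AllPairs (λ G G' → ¬ (G ≅ G')) R ×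
  (∀ G → HasEdges m G → Any (λ G' → G ≅ G') R)

_·_at_ : ∀ {n} → (Graph n → Graph n → ℕ) → List (Graph n) → Graph n → (List (Graph n) → ℕ)
(M · R at H) S = sum (map (λ G → M H G * X S G) R)

-- Weight each graph by its number of automorphisms and consider the bilinear form
-- ⟪U , V⟫ = Σ_{x ∈ U, y ∈ V} #{isomorphisms x → y} on multisets of graphs; as
-- #iso(x, y) = [x ≅ y]·aut(y), this is Σ over isomorphism classes of
-- aut · mult_U · mult_V, a positive definite form.  Removing an edge e from G and
-- matching L ≅ G − e via σ corresponds to adding the non-edge f = σ⁻¹(e) to L with
-- σ : L + f ≅ G, so ⟪ED₁ S₁ , ED₁ S₂⟫ = Σ_{G ∈ S₂} aut(G)·#{M ∈ MD₁ S₁ : M ≅ G}.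
-- Hence Δ₁X_P = Δ₁X_Q gives ⟪U − V , U − V⟫ = 0 for U = ED₁ P, V = ED₁ Q, and by
-- definiteness U and V agree class by class, which is d₁X_P = d₁X_Q.
module Submission where

open import Defs
open import Data.Nat using (ℕ; zero; suc; _+_; _*_; _^_; _≤_; s≤s; ∣_-_∣; NonZero; >-nonZero)
open import Data.Nat.Combinatorics using (_C_)
open import Data.List using (List)
open import Data.List.Relation.Unary.All using (All)
open import Relation.Binary.PropositionalEquality using (_≡_)

open import Data.Bool using (true; false; _∧_; _∨_; not; if_then_else_)
open import Data.Bool.Properties using (∨-comm; ∧-conicalˡ) renaming (_≟_ to _≟ᵇ_)
open import Data.Empty using (⊥-elim)
open import Data.Fin as F using (Fin; finToFun; funToFin; combine)
open import Data.Fin.Permutation using (Permutation′; permutation)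
open import Data.Fin.Properties using (finToFun-funToFin; funToFin-finToFin; all?; _<?_; <-cmp)
  renaming (_≟_ to _≟ᶠ_)
open import Data.List using ([]; _∷_; map; concatMap; filter; length; replicate; tabulate; cartesianProduct; allFin; _++_)
import Data.List.Relation.Unary.All as All
open import Data.List.Properties using (map-cong; map-cong-local; map-∘; map-++; length-filter)
open import Data.List.Relation.Unary.All.Properties using (concat⁺; map⁺; replicate⁺)
open import Data.Nat.ListAction using (sum)
open import Data.Nat.ListAction.Properties using (sum-++)
open import Data.Nat.Properties
  using ( +-0-commutativeMonoid; +-commutativeSemigroup; +-comm; +-identityʳ; +-cancelˡ-≡; +-mono-≤
        ; *-comm; *-zeroʳ; *-identityˡ; *-identityʳ; *-distribˡ-+; *-distribʳ-+; *-cancelˡ-≡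
        ; ≤-refl; ≤-trans; ≤-reflexive; ≤-total; m≤m+n; m≤n+m; m≤n⇒∃[o]m+o≡n
        ; m+n≡0⇒m≡0; m+n≡0⇒n≡0; m*n≡0⇒m≡0; m*n≡0⇒m≡0∨n≡0; ∣m-m+n∣≡n; ∣-∣-comm; ∣m-n∣≡0⇒m≡n )
open import Data.Nat.Tactic.RingSolver using (solve-∀)
open import Algebra.Properties.CommutativeMonoid.Sum +-0-commutativeMonoid
  using (sum-syntax; sum-cong-≗; sum-replicate-zero; ∑-comm; ∑-distrib-+; ∑-permute)
open import Algebra.Properties.CommutativeSemigroup +-commutativeSemigroup using (interchange)
open import Data.Product using (Σ; _×_; _,_; proj₁; proj₂; uncurry)
open import Data.Product.Function.NonDependent.Propositional using (_×-⇔_)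
open import Data.Sum using (_⊎_; inj₁; inj₂)
open import Function using (_∘_; id; _⇔_; mk⇔; Equivalence; case_of_)
open import Function.Definitions using (Injective)
open import Function.Properties.Equivalence using () renaming (refl to ⇔-refl; sym to ⇔-sym; trans to ⇔-trans)
open import Level using (0ℓ; _⊔_)
open import Relation.Binary.Bundles using (DecSetoid)
open import Relation.Binary.Definitions using (tri<; tri≈; tri>)
open import Relation.Binary.PropositionalEquality using (_≢_; refl; sym; trans; cong; cong₂; _≗_; module ≡-Reasoning)
open import Relation.Nullary using (Dec; yes; no; ¬_; ¬?; _×-dec_)
open import Relation.Nullary.Decidable using (map′; does; isYes; isYes≗does; does-≡; dec-false)
open import Relation.Unary using (Pred; Decidable)

𝟙 : ∀ {p} {P : Set p} → Dec P → ℕ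
𝟙 (yes _) = 1
𝟙 (no _)  = 0

module _ {p q} {P : Set p} {Q : Set q} where

  𝟙-cong : P ⇔ Q → (P? : Dec P) (Q? : Dec Q) → 𝟙 P? ≡ 𝟙 Q?
  𝟙-cong P⇔Q (yes _) (yes _) = refl
  𝟙-cong P⇔Q (yes p) (no ¬q) = ⊥-elim (¬q (Equivalence.to P⇔Q p))
  𝟙-cong P⇔Q (no ¬p) (yes q) = ⊥-elim (¬p (Equivalence.from P⇔Q q))
  𝟙-cong P⇔Q (no _)  (no _)  = refl

  𝟙-×-dec : (P? : Dec P) (Q? : Dec Q) → 𝟙 P? * 𝟙 Q? ≡ 𝟙 (P? ×-dec Q?)
  𝟙-×-dec (yes _) (yes _) = refl
  𝟙-×-dec (yes _) (no _)  = refl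
  𝟙-×-dec (no _)  _       = refl

𝟙-yes : ∀ {p} {P : Set p} (P? : Dec P) → P → 𝟙 P? ≡ 1
𝟙-yes (yes _) _  = refl
𝟙-yes (no ¬p) p = ⊥-elim (¬p p)

𝟙-no : ∀ {p} {P : Set p} (P? : Dec P) → ¬ P → 𝟙 P? ≡ 0
𝟙-no (yes p) ¬p = ⊥-elim (¬p p)
𝟙-no (no _)  _  = refl

∑ˡ : ∀ {a} {A : Set a} → (A → ℕ) → List A → ℕ
∑ˡ f xs = sum (map f xs)

infix 10 ∑ˡ
syntax ∑ˡ (λ x → e) xs = ∑[ x ∈ xs ] e

module _ {a} {A : Set a} where

  ∑ˡ-cong : ∀ {f g : A → ℕ} → f ≗ g → ∀ xs → ∑ˡ f xs ≡ ∑ˡ g xs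
  ∑ˡ-cong f≗g xs = cong sum (map-cong f≗g xs)

  ∑ˡ-cong-All : ∀ {f g : A → ℕ} {xs} → All (λ x → f x ≡ g x) xs → ∑ˡ f xs ≡ ∑ˡ g xs
  ∑ˡ-cong-All eqs = cong sum (map-cong-local eqs)

  ∑ˡ-++ : ∀ (f : A → ℕ) xs ys → ∑ˡ f (xs ++ ys) ≡ ∑ˡ f xs + ∑ˡ f ys
  ∑ˡ-++ f xs ys = trans (cong sum (map-++ f xs ys)) (sum-++ (map f xs) (map f ys))

  ∑ˡ-+ : ∀ (f g : A → ℕ) xs → ∑[ x ∈ xs ] (f x + g x) ≡ ∑ˡ f xs + ∑ˡ g xs
  ∑ˡ-+ f g []       = refl
  ∑ˡ-+ f g (x ∷ xs) = trans (cong (f x + g x +_) (∑ˡ-+ f g xs)) (interchange (f x) (g x) _ _)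

  ∑ˡ-*ˡ : ∀ c (f : A → ℕ) xs → ∑[ x ∈ xs ] (c * f x) ≡ c * ∑ˡ f xs
  ∑ˡ-*ˡ c f []       = sym (*-zeroʳ c)
  ∑ˡ-*ˡ c f (x ∷ xs) = trans (cong (c * f x +_) (∑ˡ-*ˡ c f xs)) (sym (*-distribˡ-+ c (f x) _))

  ∑ˡ-*ʳ : ∀ c (f : A → ℕ) xs → ∑[ x ∈ xs ] (f x * c) ≡ ∑ˡ f xs * c
  ∑ˡ-*ʳ c f xs = trans (∑ˡ-cong (λ x → *-comm (f x) c) xs) (trans (∑ˡ-*ˡ c f xs) (*-comm c _))

  ∑ˡ-replicate : ∀ (f : A → ℕ) k x → ∑ˡ f (replicate k x) ≡ k * f x
  ∑ˡ-replicate f zero    x = refl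
  ∑ˡ-replicate f (suc k) x = cong (f x +_) (∑ˡ-replicate f k x)

  ∑ˡ-filter : ∀ {p} {P : Pred A p} (P? : Decidable P) (f : A → ℕ) xs →
              ∑ˡ f (filter P? xs) ≡ ∑[ x ∈ xs ] (𝟙 (P? x) * f x)
  ∑ˡ-filter P? f []       = refl
  ∑ˡ-filter P? f (x ∷ xs) with P? x
  ... | yes _ = cong₂ _+_ (sym (+-identityʳ (f x))) (∑ˡ-filter P? f xs)
  ... | no _  = ∑ˡ-filter P? f xs

  length≡∑ˡ1 : ∀ (xs : List A) → length xs ≡ ∑[ x ∈ xs ] 1
  length≡∑ˡ1 []       = refl
  length≡∑ˡ1 (x ∷ xs) = cong suc (length≡∑ˡ1 xs)

  ∑ˡ-tabulate : ∀ {n} (f : A → ℕ) (g : Fin n → A) → ∑ˡ f (tabulate g) ≡ ∑[ i < n ] f (g i)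
  ∑ˡ-tabulate {zero}  f g = refl
  ∑ˡ-tabulate {suc n} f g = cong (f (g F.zero) +_) (∑ˡ-tabulate f (g ∘ F.suc))

  ∑ˡ-0 : ∀ (xs : List A) → (∑[ x ∈ xs ] 0) ≡ 0
  ∑ˡ-0 []       = refl
  ∑ˡ-0 (x ∷ xs) = ∑ˡ-0 xs

  ∑ˡ-∑-comm : ∀ {n} (f : A → Fin n → ℕ) xs → (∑[ x ∈ xs ] ∑[ i < n ] f x i) ≡ (∑[ i < n ] ∑[ x ∈ xs ] f x i)
  ∑ˡ-∑-comm {n} f []       = sym (sum-replicate-zero n)
  ∑ˡ-∑-comm {n} f (x ∷ xs) =
    trans (cong ((∑[ i < n ] f x i) +_) (∑ˡ-∑-comm f xs)) (sym (∑-distrib-+ (f x) _))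

∑ˡ-map : ∀ {a b} {A : Set a} {B : Set b} (f : B → ℕ) (g : A → B) xs → ∑ˡ f (map g xs) ≡ ∑ˡ (f ∘ g) xs
∑ˡ-map f g xs = cong sum (sym (map-∘ xs))

module _ {a b} {A : Set a} {B : Set b} where

  ∑ˡ-concatMap : ∀ (f : B → ℕ) (g : A → List B) xs → ∑ˡ f (concatMap g xs) ≡ ∑[ x ∈ xs ] ∑ˡ f (g x)
  ∑ˡ-concatMap f g []       = refl
  ∑ˡ-concatMap f g (x ∷ xs) = trans (∑ˡ-++ f (g x) (concatMap g xs)) (cong (∑ˡ f (g x) +_) (∑ˡ-concatMap f g xs))

  ∑ˡ-comm : ∀ (f : A → B → ℕ) xs ys → (∑[ x ∈ xs ] ∑[ y ∈ ys ] f x y) ≡ (∑[ y ∈ ys ] ∑[ x ∈ xs ] f x y)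
  ∑ˡ-comm f []       ys = sym (∑ˡ-0 ys)
  ∑ˡ-comm f (x ∷ xs) ys = trans (cong (∑ˡ (f x) ys +_) (∑ˡ-comm f xs ys)) (sym (∑ˡ-+ (f x) _ ys))

  ∑ˡ-cartesianProduct : ∀ (f : A × B → ℕ) xs ys →
                        ∑ˡ f (cartesianProduct xs ys) ≡ ∑[ x ∈ xs ] ∑[ y ∈ ys ] f (x , y)
  ∑ˡ-cartesianProduct f []       ys = refl
  ∑ˡ-cartesianProduct f (x ∷ xs) ys = trans (∑ˡ-++ f (map (x ,_) ys) _)
    (cong₂ _+_ (∑ˡ-map f (x ,_) ys) (∑ˡ-cartesianProduct f xs ys))

funToFin-cong : ∀ {m k} {f g : Fin m → Fin k} → f ≗ g → funToFin f ≡ funToFin g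
funToFin-cong {zero}  f≗g = refl
funToFin-cong {suc m} f≗g = cong₂ combine (f≗g F.zero) (funToFin-cong (f≗g ∘ F.suc))

∑-functions-reindex : ∀ {m k} (F : (Fin m → Fin k) → ℕ) → (∀ {f g} → f ≗ g → F f ≡ F g) →
                      (φ ψ : (Fin m → Fin k) → (Fin m → Fin k)) →
                      (∀ {f g} → f ≗ g → φ f ≗ φ g) → (∀ {f g} → f ≗ g → ψ f ≗ ψ g) →
                      (∀ f → φ (ψ f) ≗ f) → (∀ f → ψ (φ f) ≗ f) →
                      ∑[ i < k ^ m ] F (finToFun i) ≡ ∑[ i < k ^ m ] F (φ (finToFun i))
∑-functions-reindex {m} {k} F F-resp φ ψ φ-resp ψ-resp φψ ψφ =
  trans (∑-permute (F ∘ finToFun) π) (sum-cong-≗ (λ i → F-resp (finToFun-funToFin (φ (finToFun i)))))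
  where
  roundtrip : ∀ (χ ω : (Fin m → Fin k) → (Fin m → Fin k)) →
              (∀ {f g} → f ≗ g → χ f ≗ χ g) → (∀ f → χ (ω f) ≗ f) → ∀ i → funToFin (χ (finToFun (funToFin (ω (finToFun i))))) ≡ i
  roundtrip χ ω χ-resp χω i =
    trans (funToFin-cong (λ x → trans (χ-resp (finToFun-funToFin (ω (finToFun i))) x) (χω (finToFun i) x)))
          (funToFin-finToFin {m} {k} i)
  π : Permutation′ (k ^ m)
  π = permutation (funToFin ∘ φ ∘ finToFun) (funToFin ∘ ψ ∘ finToFun)
                  (roundtrip φ ψ φ-resp φψ) (roundtrip ψ φ ψ-resp ψφ)

term≤∑ : ∀ {N} (f : Fin N → ℕ) i → f i ≤ ∑[ j < N ] f j
term≤∑ f F.zero    = m≤m+n _ _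
term≤∑ f (F.suc i) = ≤-trans (term≤∑ (f ∘ F.suc) i) (m≤n+m _ (f F.zero))

-- A positive definite form on multisets modulo an equivalence

private
  square-gap-≤ : ∀ {m n} → m ≤ n → m * n + n * m + ∣ m - n ∣ * ∣ m - n ∣ ≡ m * m + n * n
  square-gap-≤ {m} m≤n with (d , refl) ← m≤n⇒∃[o]m+o≡n m≤n rewrite ∣m-m+n∣≡n m d = identity m d
    where
    identity : ∀ m d → m * (m + d) + (m + d) * m + d * d ≡ m * m + (m + d) * (m + d)
    identity = solve-∀

m*n+n*m+∣m-n∣²≡m*m+n*n : ∀ m n → m * n + n * m + ∣ m - n ∣ * ∣ m - n ∣ ≡ m * m + n * n
m*n+n*m+∣m-n∣²≡m*m+n*n m n with ≤-total m n
... | inj₁ m≤n = square-gap-≤ m≤n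
... | inj₂ n≤m = begin
  m * n + n * m + ∣ m - n ∣ * ∣ m - n ∣ ≡⟨ cong₂ (λ s t → s + t * t) (+-comm (m * n) (n * m)) (∣-∣-comm m n) ⟩
  n * m + m * n + ∣ n - m ∣ * ∣ n - m ∣ ≡⟨ square-gap-≤ n≤m ⟩
  n * n + m * m                         ≡⟨ +-comm (n * n) (m * m) ⟩
  m * m + n * n                         ∎
  where open ≡-Reasoning

module GramForm {a ℓ} (S : DecSetoid a ℓ) (weight : DecSetoid.Carrier S → ℕ)
                (weight-resp : ∀ {x y} → DecSetoid._≈_ S x y → weight x ≡ weight y)
                (weight≢0 : ∀ x → NonZero (weight x)) where

  open DecSetoid S using (Carrier; _≈_; _≟_) renaming (refl to ≈-refl; sym to ≈-sym; trans to ≈-trans)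

  ⟪_,_⟫ : List Carrier → List Carrier → ℕ
  ⟪ U , V ⟫ = ∑[ x ∈ U ] ∑[ y ∈ V ] (𝟙 (x ≟ y) * weight y)

  multiplicity : Carrier → List Carrier → ℕ
  multiplicity z U = ∑[ x ∈ U ] 𝟙 (x ≟ z)

  _∖_ : List Carrier → Carrier → List Carrier
  U ∖ w = filter (λ x → ¬? (x ≟ w)) U

  private
    kernel-split : ∀ w x y → 𝟙 (x ≟ y) * weight y ≡
                   𝟙 (x ≟ w) * (𝟙 (y ≟ w) * weight w)
                   + 𝟙 (¬? (x ≟ w)) * (𝟙 (¬? (y ≟ w)) * (𝟙 (x ≟ y) * weight y))
    kernel-split w x y with x ≟ w | y ≟ w | x ≟ y
    ... | yes _   | yes y≈w | yes _   = cong (1 *_) (trans (weight-resp y≈w) (sym (trans (+-identityʳ _) (*-identityˡ _))))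
    ... | yes x≈w | yes y≈w | no x≉y  = ⊥-elim (x≉y (≈-trans x≈w (≈-sym y≈w)))
    ... | yes x≈w | no y≉w  | yes x≈y = ⊥-elim (y≉w (≈-trans (≈-sym x≈y) x≈w))
    ... | yes _   | no _    | no _    = refl
    ... | no x≉w  | yes y≈w | yes x≈y = ⊥-elim (x≉w (≈-trans x≈y y≈w))
    ... | no _    | yes _   | no _    = refl
    ... | no _    | no _    | _       = sym (trans (*-identityˡ _) (*-identityˡ _))

  ⟪⟫-split : ∀ w U V → ⟪ U , V ⟫ ≡ multiplicity w U * (multiplicity w V * weight w) + ⟪ U ∖ w , V ∖ w ⟫
  ⟪⟫-split w U V = begin
    ⟪ U , V ⟫
      ≡⟨ ∑ˡ-cong (λ x → trans (∑ˡ-cong (kernel-split w x) V) (∑ˡ-+ _ _ V)) U ⟩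
    ∑[ x ∈ U ] ((∑[ y ∈ V ] (𝟙 (x ≟ w) * (𝟙 (y ≟ w) * weight w))) + ∑[ y ∈ V ] rest x y)
      ≡⟨ ∑ˡ-+ _ _ U ⟩
    (∑[ x ∈ U ] ∑[ y ∈ V ] (𝟙 (x ≟ w) * (𝟙 (y ≟ w) * weight w))) + (∑[ x ∈ U ] ∑[ y ∈ V ] rest x y)
      ≡⟨ cong₂ _+_ block (sym (∖-sum U V)) ⟩
    multiplicity w U * (multiplicity w V * weight w) + ⟪ U ∖ w , V ∖ w ⟫
      ∎
    where
    open ≡-Reasoning
    rest : Carrier → Carrier → ℕ
    rest x y = 𝟙 (¬? (x ≟ w)) * (𝟙 (¬? (y ≟ w)) * (𝟙 (x ≟ y) * weight y))
    block : (∑[ x ∈ U ] ∑[ y ∈ V ] (𝟙 (x ≟ w) * (𝟙 (y ≟ w) * weight w))) ≡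
            multiplicity w U * (multiplicity w V * weight w)
    block = trans (∑ˡ-cong (λ x → trans (∑ˡ-*ˡ (𝟙 (x ≟ w)) _ V) (cong (𝟙 (x ≟ w) *_) (∑ˡ-*ʳ (weight w) _ V))) U)
                  (∑ˡ-*ʳ _ _ U)
    ∖-sum : ∀ U V → ⟪ U ∖ w , V ∖ w ⟫ ≡ ∑[ x ∈ U ] ∑[ y ∈ V ] rest x y
    ∖-sum U V = trans (∑ˡ-filter ≉w (λ x → ∑[ y ∈ V ∖ w ] (𝟙 (x ≟ y) * weight y)) U)
      (∑ˡ-cong (λ x → trans (cong (𝟙 (≉w x) *_) (∑ˡ-filter ≉w (λ y → 𝟙 (x ≟ y) * weight y) V))
                            (sym (∑ˡ-*ˡ (𝟙 (≉w x)) _ V))) U)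
      where
      ≉w : ∀ x → Dec (¬ x ≈ w)
      ≉w x = ¬? (x ≟ w)

  multiplicity-resp : ∀ {z w} → z ≈ w → ∀ U → multiplicity z U ≡ multiplicity w U
  multiplicity-resp z≈w =
    ∑ˡ-cong (λ x → 𝟙-cong (mk⇔ (λ x≈z → ≈-trans x≈z z≈w) (λ x≈w → ≈-trans x≈w (≈-sym z≈w))) _ _)

  multiplicity-∖ : ∀ {z w} → ¬ z ≈ w → ∀ U → multiplicity z (U ∖ w) ≡ multiplicity z U
  multiplicity-∖ {z} {w} z≉w U = trans (∑ˡ-filter (λ x → ¬? (x ≟ w)) _ U) (∑ˡ-cong outside U)
    where
    outside : ∀ x → 𝟙 (¬? (x ≟ w)) * 𝟙 (x ≟ z) ≡ 𝟙 (x ≟ z)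
    outside x with x ≟ w | x ≟ z
    ... | yes x≈w | yes x≈z = ⊥-elim (z≉w (≈-trans (≈-sym x≈z) x≈w))
    ... | yes _   | no _    = refl
    ... | no _    | _       = +-identityʳ _

  length-∖ : ∀ w U → length ((w ∷ U) ∖ w) ≤ length U
  length-∖ w U with w ≟ w
  ... | yes _  = length-filter (λ x → ¬? (x ≟ w)) U
  ... | no w≉w = ⊥-elim (w≉w ≈-refl)

  -- d² is the sum over classes of weight · (multiplicity in U − multiplicity in V)².
  record SquaredDistance (U V : List Carrier) : Set (a ⊔ ℓ) where
    field
      d² : ℕ
      polarisation : ⟪ U , V ⟫ + ⟪ V , U ⟫ + d² ≡ ⟪ U , U ⟫ + ⟪ V , V ⟫
      d²≡0⇒multiplicity≡ : d² ≡ 0 → ∀ z → multiplicity z U ≡ multiplicity z V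

  squaredDistance-∖ : ∀ w {U V} → SquaredDistance (U ∖ w) (V ∖ w) → SquaredDistance U V
  squaredDistance-∖ w {U} {V} rest = record
    { d² = ∣ α - β ∣ * ∣ α - β ∣ * γ + R.d²
    ; polarisation = polarisation
    ; d²≡0⇒multiplicity≡ = d²≡0⇒multiplicity≡
    }
    where
    module R = SquaredDistance rest
    open ≡-Reasoning
    α β γ : ℕ
    α = multiplicity w U
    β = multiplicity w V
    γ = weight w

    polarisation : ⟪ U , V ⟫ + ⟪ V , U ⟫ + (∣ α - β ∣ * ∣ α - β ∣ * γ + R.d²) ≡ ⟪ U , U ⟫ + ⟪ V , V ⟫
    polarisation = begin
      ⟪ U , V ⟫ + ⟪ V , U ⟫ + (∣ α - β ∣ * ∣ α - β ∣ * γ + R.d²)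
        ≡⟨ cong₂ (λ s t → s + t + (∣ α - β ∣ * ∣ α - β ∣ * γ + R.d²)) (⟪⟫-split w U V) (⟪⟫-split w V U) ⟩
      α * (β * γ) + ⟪ U ∖ w , V ∖ w ⟫ + (β * (α * γ) + ⟪ V ∖ w , U ∖ w ⟫) + (∣ α - β ∣ * ∣ α - β ∣ * γ + R.d²)
        ≡⟨ regroup α β γ (∣ α - β ∣) _ _ R.d² ⟩
      (α * β + β * α + ∣ α - β ∣ * ∣ α - β ∣) * γ + (⟪ U ∖ w , V ∖ w ⟫ + ⟪ V ∖ w , U ∖ w ⟫ + R.d²)
        ≡⟨ cong₂ (λ s t → s * γ + t) (m*n+n*m+∣m-n∣²≡m*m+n*n α β) R.polarisation ⟩
      (α * α + β * β) * γ + (⟪ U ∖ w , U ∖ w ⟫ + ⟪ V ∖ w , V ∖ w ⟫)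
        ≡⟨ regroup′ α β γ _ _ ⟩
      α * (α * γ) + ⟪ U ∖ w , U ∖ w ⟫ + (β * (β * γ) + ⟪ V ∖ w , V ∖ w ⟫)
        ≡⟨ cong₂ _+_ (⟪⟫-split w U U) (⟪⟫-split w V V) ⟨
      ⟪ U , U ⟫ + ⟪ V , V ⟫
        ∎
      where
      regroup : ∀ α β γ g x y d → α * (β * γ) + x + (β * (α * γ) + y) + (g * g * γ + d) ≡
                                  (α * β + β * α + g * g) * γ + (x + y + d)
      regroup = solve-∀
      regroup′ : ∀ α β γ x y → (α * α + β * β) * γ + (x + y) ≡ α * (α * γ) + x + (β * (β * γ) + y)
      regroup′ = solve-∀

    d²≡0⇒multiplicity≡ : ∣ α - β ∣ * ∣ α - β ∣ * γ + R.d² ≡ 0 → ∀ z → multiplicity z U ≡ multiplicity z V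
    d²≡0⇒multiplicity≡ d²≡0 z with z ≟ w
    ... | yes z≈w = trans (multiplicity-resp z≈w U) (trans α≡β (sym (multiplicity-resp z≈w V)))
      where
      ∣α-β∣²≡0 : ∣ α - β ∣ * ∣ α - β ∣ ≡ 0
      ∣α-β∣²≡0 = m*n≡0⇒m≡0 _ γ {{weight≢0 w}} (m+n≡0⇒m≡0 _ d²≡0)
      α≡β : α ≡ β
      α≡β with m*n≡0⇒m≡0∨n≡0 ∣ α - β ∣ ∣α-β∣²≡0
      ... | inj₁ ∣α-β∣≡0 = ∣m-n∣≡0⇒m≡n ∣α-β∣≡0
      ... | inj₂ ∣α-β∣≡0 = ∣m-n∣≡0⇒m≡n ∣α-β∣≡0
    ... | no z≉w = trans (sym (multiplicity-∖ z≉w U))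
                     (trans (R.d²≡0⇒multiplicity≡ (m+n≡0⇒n≡0 _ d²≡0) z) (multiplicity-∖ z≉w V))

  squaredDistance : ∀ U V → SquaredDistance U V
  squaredDistance U V = bounded (length U + length V) U V ≤-refl
    where
    bounded : ∀ k U V → length U + length V ≤ k → SquaredDistance U V
    bounded _       []      []      _ = record { d² = 0 ; polarisation = refl ; d²≡0⇒multiplicity≡ = λ _ _ → refl }
    bounded (suc k) (w ∷ U) V (s≤s ≤k) = squaredDistance-∖ w (bounded k _ _
      (≤-trans (+-mono-≤ (length-∖ w U) (length-filter (λ x → ¬? (x ≟ w)) V)) ≤k))
    bounded (suc k) [] (w ∷ V) (s≤s ≤k) = squaredDistance-∖ w (bounded k [] _ (≤-trans (length-∖ w V) ≤k))

  diagonal≡cross⇒multiplicity≡ : ∀ U V → ⟪ U , U ⟫ + ⟪ V , V ⟫ ≡ ⟪ U , V ⟫ + ⟪ V , U ⟫ →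
                                 ∀ z → multiplicity z U ≡ multiplicity z V
  diagonal≡cross⇒multiplicity≡ U V diagonal≡cross = d²≡0⇒multiplicity≡
    (+-cancelˡ-≡ (⟪ U , V ⟫ + ⟪ V , U ⟫) d² 0 (trans polarisation (trans diagonal≡cross (sym (+-identityʳ _)))))
    where open SquaredDistance (squaredDistance U V)

module _ {n : ℕ} where

  infix 4 _≐_
  _≐_ : Graph n → Graph n → Set
  G ≐ H = ∀ x y → adj G x y ≡ adj H x y

  pullback : (Fin n → Fin n) → Graph n → Graph n
  pullback σ G = record
    { adj        = λ x y → adj G (σ x) (σ y)
    ; adj-sym    = λ x y → adj-sym G (σ x) (σ y)
    ; adj-irrefl = λ x → adj-irrefl G (σ x)
    }

  ==-injective : ∀ {σ : Fin n → Fin n} → Injective _≡_ _≡_ σ → ∀ x y → (σ x == σ y) ≡ (x == y)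
  ==-injective {σ} inj x y = begin
    isYes (σ x ≟ᶠ σ y)                    ≡⟨ isYes≗does _ ⟩
    does (σ x ≟ᶠ σ y)                     ≡⟨ does-≡ (σ x ≟ᶠ σ y) (map′ (cong σ) inj (x ≟ᶠ y)) ⟩
    does (x ≟ᶠ y)                         ≡⟨ isYes≗does _ ⟨
    isYes (x ≟ᶠ y)                        ∎
    where open ≡-Reasoning

  pullback-setEdge : ∀ {σ : Fin n → Fin n} → Injective _≡_ _≡_ σ → ∀ G i j b →
                     pullback σ (setEdge G (σ i , σ j) b) ≐ setEdge (pullback σ G) (i , j) b
  pullback-setEdge inj G i j b x y = cong (λ c → if c then b else adj G _ _)
    (cong₂ _∧_ (cong₂ _∨_ (cong₂ _∧_ (σ== x i) (σ== y j)) (cong₂ _∧_ (σ== x j) (σ== y i))) (cong not (σ== x y)))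
    where σ== = ==-injective inj

  setEdge-swap : ∀ G (i j : Fin n) b → setEdge G (i , j) b ≐ setEdge G (j , i) b
  setEdge-swap G i j b x y = cong (λ c → if c ∧ not (x == y) then b else adj G x y) (∨-comm (x == i ∧ y == j) _)

  setEdge-self : ∀ G {i j : Fin n} b → i ≢ j → adj (setEdge G (i , j) b) i j ≡ b
  setEdge-self G {i} {j} b i≢j rewrite ==-refl i | ==-refl j | trans (isYes≗does (i ≟ᶠ j)) (dec-false (i ≟ᶠ j) i≢j) = refl

  samePair⇒≡ : ∀ {x y i j : Fin n} → samePair x y i j ≡ true → (x ≡ i × y ≡ j) ⊎ (x ≡ j × y ≡ i)
  samePair⇒≡ {x} {y} {i} {j} eq with x ≟ᶠ i | y ≟ᶠ j | x ≟ᶠ j | y ≟ᶠ i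
  ... | yes x≡i | yes y≡j | _       | _       = inj₁ (x≡i , y≡j)
  ... | _       | _       | yes x≡j | yes y≡i = inj₂ (x≡j , y≡i)
  ... | no _    | _       | no _    | _       = case eq of λ ()
  ... | no _    | _       | yes _   | no _    = case eq of λ ()
  ... | yes _   | no _    | no _    | _       = case eq of λ ()
  ... | yes _   | no _    | yes _   | no _    = case eq of λ ()

  adj-samePair : ∀ G {x y i j : Fin n} → samePair x y i j ∧ not (x == y) ≡ true → adj G x y ≡ adj G i j
  adj-samePair G {x} {y} {i} {j} eq with samePair⇒≡ {x} {y} {i} {j} (∧-conicalˡ _ _ eq)
  ... | inj₁ (refl , refl) = refl
  ... | inj₂ (refl , refl) = adj-sym G _ _

  removeEdge≐⇔≐addEdge : ∀ (A L : Graph n) {i j} → i ≢ j →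
    (adj A i j ≡ true × removeEdge A (i , j) ≐ L) ⇔ (adj L i j ≡ false × A ≐ addEdge L (i , j))
  removeEdge≐⇔≐addEdge A L {i} {j} i≢j = mk⇔ to from
    where
    to : adj A i j ≡ true × removeEdge A (i , j) ≐ L → adj L i j ≡ false × A ≐ addEdge L (i , j)
    to (ij∈A , A-ij≐L) = trans (sym (A-ij≐L i j)) (setEdge-self A false i≢j) , A≐L+ij
      where
      A≐L+ij : A ≐ addEdge L (i , j)
      A≐L+ij x y with samePair x y i j ∧ not (x == y) in onPair
      ... | true  = trans (adj-samePair A onPair) ij∈A
      ... | false = trans (cong (λ c → if c then false else adj A x y) (sym onPair)) (A-ij≐L x y)

    from : adj L i j ≡ false × A ≐ addEdge L (i , j) → adj A i j ≡ true × removeEdge A (i , j) ≐ L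
    from (ij∉L , A≐L+ij) = trans (A≐L+ij i j) (setEdge-self L true i≢j) , A-ij≐L
      where
      A-ij≐L : removeEdge A (i , j) ≐ L
      A-ij≐L x y with samePair x y i j ∧ not (x == y) in onPair
      ... | true  = sym (trans (adj-samePair L onPair) ij∉L)
      ... | false = trans (A≐L+ij x y) (cong (λ c → if c then true else adj L x y) onPair)

  Inverses : (Fin n → Fin n) → (Fin n → Fin n) → Set
  Inverses σ τ = (∀ i → τ (σ i) ≡ i) × (∀ i → σ (τ i) ≡ i)

  inverses⇒injective : ∀ {σ τ} → Inverses σ τ → Injective _≡_ _≡_ σ
  inverses⇒injective {τ = τ} (τσ , _) {x} {y} σx≡σy = trans (sym (τσ x)) (trans (cong τ σx≡σy) (τσ y))

  Invertible : (Fin n → Fin n) → Set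
  Invertible σ = Σ (Fin n → Fin n) (Inverses σ)

  invertible? : ∀ σ → Dec (Invertible σ)
  invertible? σ = ∃fun? (Inverses σ) resp (λ τ → all? (λ i → τ (σ i) ≟ᶠ i) ×-dec all? (λ i → σ (τ i) ≟ᶠ i))
    where
    resp : ∀ {τ τ′} → τ ≗ τ′ → Inverses σ τ → Inverses σ τ′
    resp τ≗τ′ (τσ , στ) =
      (λ i → trans (sym (τ≗τ′ (σ i))) (τσ i)) , (λ i → trans (cong σ (sym (τ≗τ′ i))) (στ i))

  record IsoVia (σ : Fin n → Fin n) (G H : Graph n) : Set where
    constructor isoVia
    field
      inverse : Fin n → Fin n
      isIso   : IsIso G H σ inverse

  ≅⇒isoVia : ∀ {G H} (G≅H : G ≅ H) → IsoVia (proj₁ G≅H) G H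
  ≅⇒isoVia (_ , τ , iso) = isoVia τ iso

  isoVia⇒≅ : ∀ {σ G H} → IsoVia σ G H → G ≅ H
  isoVia⇒≅ (isoVia τ iso) = _ , τ , iso

  isoVia? : ∀ σ G H → Dec (IsoVia σ G H)
  isoVia? σ G H =
    map′ (λ (τ , iso) → isoVia τ iso) (λ (isoVia τ iso) → τ , iso) (∃fun? (IsIso G H σ) resp (IsIso? G H σ))
    where
    resp : ∀ {τ τ′} → τ ≗ τ′ → IsIso G H σ τ → IsIso G H σ τ′
    resp τ≗τ′ (τσ , στ , preserves) =
      (λ i → trans (sym (τ≗τ′ (σ i))) (τσ i)) , (λ i → trans (cong σ (sym (τ≗τ′ i))) (στ i)) , preserves

  isoVia⇒invertible : ∀ {σ G H} → IsoVia σ G H → Invertible σ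
  isoVia⇒invertible (isoVia τ (τσ , στ , _)) = τ , τσ , στ

  isoVia-resp-≗ : ∀ {σ σ′ G H} → σ ≗ σ′ → IsoVia σ G H → IsoVia σ′ G H
  isoVia-resp-≗ {H = H} σ≗σ′ (isoVia τ (τσ , στ , preserves)) = isoVia τ
    ( (λ i → trans (cong τ (sym (σ≗σ′ i))) (τσ i))
    , (λ i → trans (sym (σ≗σ′ (τ i))) (στ i))
    , (λ i j → trans (cong₂ (adj H) (sym (σ≗σ′ i)) (sym (σ≗σ′ j))) (preserves i j)) )

  isoVia-resp-≐ : ∀ {σ G G′ H H′} → G ≐ G′ → H ≐ H′ → IsoVia σ G H → IsoVia σ G′ H′
  isoVia-resp-≐ {σ} G≐G′ H≐H′ (isoVia τ (τσ , στ , preserves)) =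
    isoVia τ (τσ , στ , λ i j → trans (sym (H≐H′ (σ i) (σ j))) (trans (preserves i j) (G≐G′ i j)))

  isoVia-id : ∀ {G} → IsoVia id G G
  isoVia-id = isoVia id ((λ _ → refl) , (λ _ → refl) , (λ _ _ → refl))

  isoVia-∘ : ∀ {σ ρ A B C} → IsoVia σ B C → IsoVia ρ A B → IsoVia (σ ∘ ρ) A C
  isoVia-∘ {σ} {ρ} (isoVia τ (τσ , στ , σ-pres)) (isoVia τ′ (τ′ρ , ρτ′ , ρ-pres)) = isoVia (τ′ ∘ τ)
    ( (λ i → trans (cong τ′ (τσ (ρ i))) (τ′ρ i))
    , (λ i → trans (cong σ (ρτ′ (τ i))) (στ i))
    , (λ i j → trans (σ-pres (ρ i) (ρ j)) (ρ-pres i j)) )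

  isoVia-inverse : ∀ {σ A B} (iso : IsoVia σ A B) → IsoVia (IsoVia.inverse iso) B A
  isoVia-inverse {σ} {B = B} (isoVia τ (τσ , στ , preserves)) =
    isoVia σ (στ , τσ , λ i j → trans (sym (preserves (τ i) (τ j))) (cong₂ (adj B) (στ i) (στ j)))

  isoVia⇔pullback≐ : ∀ {σ τ} → Inverses σ τ → ∀ {G H} → IsoVia σ G H ⇔ (pullback σ H ≐ G)
  isoVia⇔pullback≐ {τ = τ} (τσ , στ) =
    mk⇔ (λ (isoVia _ (_ , _ , preserves)) → preserves) (λ preserves → isoVia τ (τσ , στ , preserves))

-- Counting isomorphisms

module _ {n : ℕ} where

  ≅-decSetoid : DecSetoid 0ℓ 0ℓ
  ≅-decSetoid = record
    { Carrier          = Graph n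
    ; _≈_              = _≅_
    ; isDecEquivalence = record
      { isEquivalence = record
        { refl  = λ {G} → isoVia⇒≅ (isoVia-id {G = G})
        ; sym   = λ {G} {H} G≅H → isoVia⇒≅ (isoVia-inverse (≅⇒isoVia {G = G} {H} G≅H))
        ; trans = λ {A} {B} {C} A≅B B≅C →
                    isoVia⇒≅ (isoVia-∘ (≅⇒isoVia {G = B} {C} B≅C) (≅⇒isoVia {G = A} {B} A≅B))
        }
      ; _≟_ = _≅?_
      }
    }

  -- σ runs over all n ^ n maps Fin n → Fin n; only bijections can satisfy IsoVia.
  isoCount : Graph n → Graph n → ℕ
  isoCount G H = ∑[ k < n ^ n ] 𝟙 (isoVia? (finToFun k) G H)

  private
    𝟙-isoVia-resp-≗ : ∀ G H {σ σ′ : Fin n → Fin n} → σ ≗ σ′ → 𝟙 (isoVia? σ G H) ≡ 𝟙 (isoVia? σ′ G H)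
    𝟙-isoVia-resp-≗ G H {σ} {σ′} σ≗σ′ =
      𝟙-cong (mk⇔ (isoVia-resp-≗ σ≗σ′) (isoVia-resp-≗ (sym ∘ σ≗σ′))) (isoVia? σ G H) (isoVia? σ′ G H)

  isoCount-respˡ : ∀ {A A′} B → A ≅ A′ → isoCount A B ≡ isoCount A′ B
  isoCount-respˡ {A} {A′} B A≅A′@(ρ , ρ⁻¹ , ρ⁻¹ρ , ρρ⁻¹ , _) = trans
    (∑-functions-reindex (λ σ → 𝟙 (isoVia? σ A B)) (𝟙-isoVia-resp-≗ A B) (_∘ ρ) (_∘ ρ⁻¹)
      (λ f≗g → f≗g ∘ ρ) (λ f≗g → f≗g ∘ ρ⁻¹) (λ f → cong f ∘ ρ⁻¹ρ) (λ f → cong f ∘ ρρ⁻¹))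
    (sum-cong-≗ (λ k → 𝟙-cong (precompose (finToFun k)) (isoVia? _ A B) (isoVia? _ A′ B)))
    where
    ρ-iso : IsoVia ρ A A′
    ρ-iso = ≅⇒isoVia A≅A′
    precompose : ∀ σ → IsoVia (σ ∘ ρ) A B ⇔ IsoVia σ A′ B
    precompose σ = mk⇔ (λ σρ-iso → isoVia-resp-≗ (cong σ ∘ ρρ⁻¹) (isoVia-∘ σρ-iso (isoVia-inverse ρ-iso)))
                       (λ σ-iso → isoVia-∘ σ-iso ρ-iso)

  isoCount-respʳ : ∀ A {B B′} → B ≅ B′ → isoCount A B ≡ isoCount A B′
  isoCount-respʳ A {B} {B′} B≅B′@(ρ , ρ⁻¹ , ρ⁻¹ρ , ρρ⁻¹ , _) = sym (trans
    (∑-functions-reindex (λ σ → 𝟙 (isoVia? σ A B′)) (𝟙-isoVia-resp-≗ A B′) (ρ ∘_) (ρ⁻¹ ∘_)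
      (λ f≗g → cong ρ ∘ f≗g) (λ f≗g → cong ρ⁻¹ ∘ f≗g) (λ f → ρρ⁻¹ ∘ f) (λ f → ρ⁻¹ρ ∘ f))
    (sum-cong-≗ (λ k → 𝟙-cong (postcompose (finToFun k)) (isoVia? _ A B′) (isoVia? _ A B))))
    where
    ρ-iso : IsoVia ρ B B′
    ρ-iso = ≅⇒isoVia B≅B′
    postcompose : ∀ σ → IsoVia (ρ ∘ σ) A B′ ⇔ IsoVia σ A B
    postcompose σ = mk⇔ (λ ρσ-iso → isoVia-resp-≗ (ρ⁻¹ρ ∘ σ) (isoVia-∘ (isoVia-inverse ρ-iso) ρσ-iso))
                        (λ σ-iso → isoVia-∘ ρ-iso σ-iso)

  isoCount-≇ : ∀ {A B} → ¬ A ≅ B → isoCount A B ≡ 0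
  isoCount-≇ {A} {B} A≇B = trans (sum-cong-≗ (λ k → 𝟙-no (isoVia? (finToFun k) A B) (A≇B ∘ isoVia⇒≅)))
                                 (sum-replicate-zero (n ^ n))

  autCount : Graph n → ℕ
  autCount G = isoCount G G

  autCount≢0 : ∀ G → NonZero (autCount G)
  autCount≢0 G =
    >-nonZero (≤-trans (≤-reflexive (sym identity-counted)) (term≤∑ (λ k → 𝟙 (isoVia? (finToFun k) G G)) idₖ))
    where
    idₖ : Fin (n ^ n)
    idₖ = funToFin {n} id
    identity-counted : 𝟙 (isoVia? (finToFun idₖ) G G) ≡ 1
    identity-counted = 𝟙-yes (isoVia? _ G G) (isoVia-resp-≗ (sym ∘ finToFun-funToFin id) isoVia-id)

  autCount-resp : ∀ {A B} → A ≅ B → autCount A ≡ autCount B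
  autCount-resp {A} {B} A≅B = trans (isoCount-respʳ A A≅B) (isoCount-respˡ B A≅B)

  isoCount≡𝟙*autCount : ∀ A B → isoCount A B ≡ 𝟙 (A ≅? B) * autCount B
  isoCount≡𝟙*autCount A B with A ≅? B
  ... | yes A≅B = trans (isoCount-respˡ B A≅B) (sym (+-identityʳ _))
  ... | no A≇B  = isoCount-≇ A≇B

-- Trading a deleted edge for an added non-edge

module _ {n : ℕ} where

  𝟙<+𝟙>≡𝟙≢ : ∀ (i j : Fin n) → 𝟙 (i <? j) + 𝟙 (j <? i) ≡ 𝟙 (¬? (i ≟ᶠ j))
  𝟙<+𝟙>≡𝟙≢ i j with <-cmp i j
  ... | tri< i<j i≢j j≮i =
    trans (cong₂ _+_ (𝟙-yes (i <? j) i<j) (𝟙-no (j <? i) j≮i)) (sym (𝟙-yes (¬? (i ≟ᶠ j)) i≢j))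
  ... | tri≈ i≮j i≡j j≮i =
    trans (cong₂ _+_ (𝟙-no (i <? j) i≮j) (𝟙-no (j <? i) j≮i)) (sym (𝟙-no (¬? (i ≟ᶠ j)) (λ i≢j → i≢j i≡j)))
  ... | tri> i≮j i≢j j<i =
    trans (cong₂ _+_ (𝟙-no (i <? j) i≮j) (𝟙-yes (j <? i) j<i)) (sym (𝟙-yes (¬? (i ≟ᶠ j)) i≢j))

  ∑-pairs : ∀ (h : Fin n → Fin n → ℕ) → ∑[ p ∈ pairs n ] uncurry h p ≡ ∑[ i < n ] ∑[ j < n ] (𝟙 (i <? j) * h i j)
  ∑-pairs h = begin
    ∑[ p ∈ pairs n ] uncurry h p
      ≡⟨ ∑ˡ-filter (λ p → proj₁ p <? proj₂ p) (uncurry h) (cartesianProduct (allFin n) (allFin n)) ⟩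
    ∑[ p ∈ cartesianProduct (allFin n) (allFin n) ] (𝟙 (proj₁ p <? proj₂ p) * uncurry h p)
      ≡⟨ ∑ˡ-cartesianProduct (λ p → 𝟙 (proj₁ p <? proj₂ p) * uncurry h p) (allFin n) (allFin n) ⟩
    ∑[ i ∈ allFin n ] ∑[ j ∈ allFin n ] (𝟙 (i <? j) * h i j)
      ≡⟨ trans (∑ˡ-tabulate (λ i → ∑[ j ∈ allFin n ] (𝟙 (i <? j) * h i j)) id)
               (sum-cong-≗ (λ i → ∑ˡ-tabulate (λ j → 𝟙 (i <? j) * h i j) id)) ⟩
    ∑[ i < n ] ∑[ j < n ] (𝟙 (i <? j) * h i j)
      ∎
    where open ≡-Reasoning

  2*∑-pairs : ∀ (h : Fin n → Fin n → ℕ) → (∀ i j → h i j ≡ h j i) →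
              2 * ∑[ p ∈ pairs n ] uncurry h p ≡ ∑[ i < n ] ∑[ j < n ] (𝟙 (¬? (i ≟ᶠ j)) * h i j)
  2*∑-pairs h h-sym = begin
    2 * ∑[ p ∈ pairs n ] uncurry h p
      ≡⟨ cong (λ s → s + (s + 0)) (∑-pairs h) ⟩
    S + (S + 0)
      ≡⟨ cong (S +_) (trans (+-identityʳ S) transposed) ⟩
    S + ∑[ i < n ] ∑[ j < n ] (𝟙 (j <? i) * h i j)
      ≡⟨ ∑-distrib-+ (λ i → ∑[ j < n ] (𝟙 (i <? j) * h i j)) _ ⟨
    ∑[ i < n ] ((∑[ j < n ] (𝟙 (i <? j) * h i j)) + ∑[ j < n ] (𝟙 (j <? i) * h i j))
      ≡⟨ sum-cong-≗ (λ i → sym (∑-distrib-+ (λ j → 𝟙 (i <? j) * h i j) _)) ⟩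
    ∑[ i < n ] ∑[ j < n ] (𝟙 (i <? j) * h i j + 𝟙 (j <? i) * h i j)
      ≡⟨ sum-cong-≗ (λ i → sum-cong-≗ (λ j →
           trans (sym (*-distribʳ-+ (h i j) (𝟙 (i <? j)) (𝟙 (j <? i)))) (cong (_* h i j) (𝟙<+𝟙>≡𝟙≢ i j)))) ⟩
    ∑[ i < n ] ∑[ j < n ] (𝟙 (¬? (i ≟ᶠ j)) * h i j)
      ∎
    where
    open ≡-Reasoning
    S : ℕ
    S = ∑[ i < n ] ∑[ j < n ] (𝟙 (i <? j) * h i j)
    transposed : S ≡ ∑[ i < n ] ∑[ j < n ] (𝟙 (j <? i) * h i j)
    transposed = trans (∑-comm (λ i j → 𝟙 (i <? j) * h i j))
                       (sum-cong-≗ (λ i → sum-cong-≗ (λ j → cong (𝟙 (j <? i) *_) (h-sym j i))))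

  ∑∑-permute : ∀ {σ τ : Fin n → Fin n} → Inverses σ τ → ∀ (f : Fin n → Fin n → ℕ) →
               ∑[ i < n ] ∑[ j < n ] f i j ≡ ∑[ i < n ] ∑[ j < n ] f (σ i) (σ j)
  ∑∑-permute {σ} {τ} (τσ , στ) f =
    trans (∑-permute (λ i → ∑[ j < n ] f i j) π) (sum-cong-≗ (λ i → ∑-permute (f (σ i)) π))
    where
    π : Permutation′ n
    π = permutation σ τ στ τσ

  edge-exchange : ∀ {σ τ : Fin n → Fin n} → Inverses σ τ → ∀ L G {i j} → i ≢ j →
    (adj G (σ i) (σ j) ≡ true × IsoVia σ L (removeEdge G (σ i , σ j))) ⇔
    (adj L i j ≡ false × IsoVia σ (addEdge L (i , j)) G)
  edge-exchange {σ} inv L G {i} {j} i≢j =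
    ⇔-trans (⇔-refl ×-⇔ ⇔-trans (isoVia⇔pullback≐ inv) pullback-removeEdge)
   (⇔-trans (removeEdge≐⇔≐addEdge (pullback σ G) L i≢j)
            (⇔-refl ×-⇔ ⇔-sym (isoVia⇔pullback≐ inv)))
    where
    pullback-removeEdge : (pullback σ (removeEdge G (σ i , σ j)) ≐ L) ⇔ (removeEdge (pullback σ G) (i , j) ≐ L)
    pullback-removeEdge = mk⇔ (λ h x y → trans (sym (commute x y)) (h x y)) (λ h x y → trans (commute x y) (h x y))
      where
      commute : pullback σ (removeEdge G (σ i , σ j)) ≐ removeEdge (pullback σ G) (i , j)
      commute = pullback-setEdge (inverses⇒injective inv) G i j false

  -- Doubling both sums turns
  -- them into sums over ordered pairs i ≢ j, which σ permutes, and edge-exchange matches the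
  -- term for the non-edge {i , j} of L with the term for the edge {σ i , σ j} of G.
  isoVia-exchange : ∀ σ L G → ∑[ e ∈ edges G ] 𝟙 (isoVia? σ L (removeEdge G e)) ≡
                              ∑[ f ∈ nonEdges L ] 𝟙 (isoVia? σ (addEdge L f) G)
  isoVia-exchange σ L G with invertible? σ
  ... | no ¬inv = trans (none (λ _ → L) (removeEdge G) (edges G)) (sym (none (addEdge L) (λ _ → G) (nonEdges L)))
    where
    none : ∀ {X : Set} (A B : X → Graph n) xs → ∑[ x ∈ xs ] 𝟙 (isoVia? σ (A x) (B x)) ≡ 0
    none A B xs = trans (∑ˡ-cong (λ x → 𝟙-no (isoVia? σ (A x) (B x)) (¬inv ∘ isoVia⇒invertible)) xs) (∑ˡ-0 xs)
  ... | yes (_ , inv) = *-cancelˡ-≡ _ _ 2 (begin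
    2 * ∑[ e ∈ edges G ] 𝟙 (isoVia? σ L (removeEdge G e))
      ≡⟨ cong (2 *_) (∑ˡ-filter (λ p → adj G (proj₁ p) (proj₂ p) ≟ᵇ true) _ (pairs n)) ⟩
    2 * ∑[ p ∈ pairs n ] uncurry removable p
      ≡⟨ 2*∑-pairs removable removable-sym ⟩
    ∑[ i < n ] ∑[ j < n ] (𝟙 (¬? (i ≟ᶠ j)) * removable i j)
      ≡⟨ ∑∑-permute {σ = σ} inv (λ i j → 𝟙 (¬? (i ≟ᶠ j)) * removable i j) ⟩
    ∑[ i < n ] ∑[ j < n ] (𝟙 (¬? (σ i ≟ᶠ σ j)) * removable (σ i) (σ j))
      ≡⟨ sum-cong-≗ (λ i → sum-cong-≗ (exchange i)) ⟩
    ∑[ i < n ] ∑[ j < n ] (𝟙 (¬? (i ≟ᶠ j)) * addable i j)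
      ≡⟨ 2*∑-pairs addable addable-sym ⟨
    2 * ∑[ p ∈ pairs n ] uncurry addable p
      ≡⟨ cong (2 *_) (∑ˡ-filter (λ p → adj L (proj₁ p) (proj₂ p) ≟ᵇ false) _ (pairs n)) ⟨
    2 * ∑[ f ∈ nonEdges L ] 𝟙 (isoVia? σ (addEdge L f) G)
      ∎)
    where
    open ≡-Reasoning
    removable addable : Fin n → Fin n → ℕ
    removable x y = 𝟙 (adj G x y ≟ᵇ true) * 𝟙 (isoVia? σ L (removeEdge G (x , y)))
    addable   x y = 𝟙 (adj L x y ≟ᵇ false) * 𝟙 (isoVia? σ (addEdge L (x , y)) G)

    removable-sym : ∀ x y → removable x y ≡ removable y x
    removable-sym x y = cong₂ _*_ (cong (λ b → 𝟙 (b ≟ᵇ true)) (adj-sym G x y))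
      (𝟙-cong (mk⇔ (isoVia-resp-≐ (λ _ _ → refl) (setEdge-swap G x y false))
                   (isoVia-resp-≐ (λ _ _ → refl) (setEdge-swap G y x false)))
              (isoVia? σ L (removeEdge G (x , y))) (isoVia? σ L (removeEdge G (y , x))))

    addable-sym : ∀ x y → addable x y ≡ addable y x
    addable-sym x y = cong₂ _*_ (cong (λ b → 𝟙 (b ≟ᵇ false)) (adj-sym L x y))
      (𝟙-cong (mk⇔ (isoVia-resp-≐ (setEdge-swap L x y true) (λ _ _ → refl))
                   (isoVia-resp-≐ (setEdge-swap L y x true) (λ _ _ → refl)))
              (isoVia? σ (addEdge L (x , y)) G) (isoVia? σ (addEdge L (y , x)) G))

    exchange : ∀ i j → 𝟙 (¬? (σ i ≟ᶠ σ j)) * removable (σ i) (σ j) ≡ 𝟙 (¬? (i ≟ᶠ j)) * addable i j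
    exchange i j with i ≟ᶠ j
    ... | yes refl = cong (_* removable (σ i) (σ i)) (𝟙-no (¬? (σ i ≟ᶠ σ i)) (λ σi≢σi → σi≢σi refl))
    ... | no i≢j   = cong₂ _*_ (𝟙-yes (¬? (σ i ≟ᶠ σ j)) (i≢j ∘ inverses⇒injective inv))
      (begin
        removable (σ i) (σ j)
          ≡⟨ 𝟙-×-dec (adj G (σ i) (σ j) ≟ᵇ true) (isoVia? σ L (removeEdge G (σ i , σ j))) ⟩
        𝟙 ((adj G (σ i) (σ j) ≟ᵇ true) ×-dec isoVia? σ L (removeEdge G (σ i , σ j)))
          ≡⟨ 𝟙-cong (edge-exchange inv L G i≢j) _ _ ⟩
        𝟙 ((adj L i j ≟ᵇ false) ×-dec isoVia? σ (addEdge L (i , j)) G)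
          ≡⟨ 𝟙-×-dec (adj L i j ≟ᵇ false) (isoVia? σ (addEdge L (i , j)) G) ⟨
        addable i j
          ∎)

  isoCount-exchange : ∀ L G → ∑[ e ∈ edges G ] isoCount L (removeEdge G e) ≡ ∑[ f ∈ nonEdges L ] isoCount (addEdge L f) G
  isoCount-exchange L G = begin
    ∑[ e ∈ edges G ] isoCount L (removeEdge G e)
      ≡⟨ ∑ˡ-∑-comm (λ e k → 𝟙 (isoVia? (finToFun k) L (removeEdge G e))) (edges G) ⟩
    ∑[ k < n ^ n ] ∑[ e ∈ edges G ] 𝟙 (isoVia? (finToFun k) L (removeEdge G e))
      ≡⟨ sum-cong-≗ (λ k → isoVia-exchange (finToFun k) L G) ⟩
    ∑[ k < n ^ n ] ∑[ f ∈ nonEdges L ] 𝟙 (isoVia? (finToFun k) (addEdge L f) G)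
      ≡⟨ ∑ˡ-∑-comm (λ f k → 𝟙 (isoVia? (finToFun k) (addEdge L f) G)) (nonEdges L) ⟨
    ∑[ f ∈ nonEdges L ] isoCount (addEdge L f) G
      ∎
    where open ≡-Reasoning

module _ {n : ℕ} where

  open GramForm (≅-decSetoid {n}) autCount autCount-resp autCount≢0

  count≡multiplicity : ∀ H S → count H S ≡ multiplicity H S
  count≡multiplicity H S = begin
    length (filter (_≅? H) S)               ≡⟨ length≡∑ˡ1 (filter (_≅? H) S) ⟩
    ∑[ x ∈ filter (_≅? H) S ] 1              ≡⟨ ∑ˡ-filter (_≅? H) (λ _ → 1) S ⟩
    ∑[ x ∈ S ] (𝟙 (x ≅? H) * 1)              ≡⟨ ∑ˡ-cong (λ x → *-identityʳ (𝟙 (x ≅? H))) S ⟩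
    multiplicity H S                         ∎
    where open ≡-Reasoning

  expand : List (Graph n) → List (Graph n) → List (Graph n)
  expand R S = concatMap (λ K → replicate (count K S) K) R

  ·-at≡count-concatMap : ∀ (deck : Graph n → List (Graph n)) H R S →
                         ((λ H′ G → count H′ (deck G)) · R at H) S ≡ count H (concatMap deck (expand R S))
  ·-at≡count-concatMap deck H R S = sym (begin
    count H (concatMap deck (expand R S))
      ≡⟨ count≡multiplicity H (concatMap deck (expand R S)) ⟩
    ∑[ x ∈ concatMap deck (expand R S) ] 𝟙 (x ≅? H)
      ≡⟨ ∑ˡ-concatMap _ deck (expand R S) ⟩
    ∑[ x ∈ expand R S ] multiplicity H (deck x)
      ≡⟨ ∑ˡ-concatMap _ (λ K → replicate (count K S) K) R ⟩
    ∑[ K ∈ R ] ∑[ x ∈ replicate (count K S) K ] multiplicity H (deck x)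
      ≡⟨ ∑ˡ-cong (λ K → trans (∑ˡ-replicate _ (count K S) K) (*-comm (count K S) _)) R ⟩
    ∑[ K ∈ R ] (multiplicity H (deck K) * count K S)
      ≡⟨ ∑ˡ-cong (λ K → cong (_* count K S) (count≡multiplicity H (deck K))) R ⟨
    ((λ H′ G → count H′ (deck G)) · R at H) S
      ∎)
    where open ≡-Reasoning

  ∑-concatMap-MD1 : ∀ (h : Graph n → ℕ) S →
    ∑ˡ h (concatMap MD1 S) ≡ ∑[ x ∈ concatMap ED1 S ] ∑[ f ∈ nonEdges x ] h (addEdge x f)
  ∑-concatMap-MD1 h S = begin
    ∑ˡ h (concatMap MD1 S)
      ≡⟨ ∑ˡ-concatMap h MD1 S ⟩
    ∑[ G ∈ S ] ∑ˡ h (MD1 G)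
      ≡⟨ ∑ˡ-cong (λ G → ∑ˡ-concatMap h (λ e → map (addEdge (removeEdge G e)) (nonEdges (removeEdge G e))) (edges G)) S ⟩
    ∑[ G ∈ S ] ∑[ e ∈ edges G ] ∑ˡ h (map (addEdge (removeEdge G e)) (nonEdges (removeEdge G e)))
      ≡⟨ ∑ˡ-cong (λ G → ∑ˡ-cong (λ e → ∑ˡ-map h _ (nonEdges (removeEdge G e))) (edges G)) S ⟩
    ∑[ G ∈ S ] ∑[ e ∈ edges G ] ∑[ f ∈ nonEdges (removeEdge G e) ] h (addEdge (removeEdge G e) f)
      ≡⟨ ∑ˡ-cong (λ G → ∑ˡ-map _ (removeEdge G) (edges G)) S ⟨
    ∑[ G ∈ S ] ∑[ x ∈ ED1 G ] ∑[ f ∈ nonEdges x ] h (addEdge x f)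
      ≡⟨ ∑ˡ-concatMap _ ED1 S ⟨
    ∑[ x ∈ concatMap ED1 S ] ∑[ f ∈ nonEdges x ] h (addEdge x f)
      ∎
    where open ≡-Reasoning

  ⟪ED1,ED1⟫ : ∀ S₁ S₂ → ⟪ concatMap ED1 S₁ , concatMap ED1 S₂ ⟫ ≡
                        ∑[ G ∈ S₂ ] (autCount G * count G (concatMap MD1 S₁))
  ⟪ED1,ED1⟫ S₁ S₂ = begin
    ⟪ concatMap ED1 S₁ , concatMap ED1 S₂ ⟫
      ≡⟨ ∑ˡ-cong (λ x → ∑ˡ-cong (λ y → isoCount≡𝟙*autCount x y) (concatMap ED1 S₂)) (concatMap ED1 S₁) ⟨
    ∑[ x ∈ concatMap ED1 S₁ ] ∑[ y ∈ concatMap ED1 S₂ ] isoCount x y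
      ≡⟨ ∑ˡ-cong (λ x → trans (∑ˡ-concatMap _ ED1 S₂) (∑ˡ-cong (λ G → ∑ˡ-map _ (removeEdge G) (edges G)) S₂))
                 (concatMap ED1 S₁) ⟩
    ∑[ x ∈ concatMap ED1 S₁ ] ∑[ G ∈ S₂ ] ∑[ e ∈ edges G ] isoCount x (removeEdge G e)
      ≡⟨ ∑ˡ-cong (λ x → ∑ˡ-cong (isoCount-exchange x) S₂) (concatMap ED1 S₁) ⟩
    ∑[ x ∈ concatMap ED1 S₁ ] ∑[ G ∈ S₂ ] ∑[ f ∈ nonEdges x ] isoCount (addEdge x f) G
      ≡⟨ ∑ˡ-comm _ (concatMap ED1 S₁) S₂ ⟩
    ∑[ G ∈ S₂ ] ∑[ x ∈ concatMap ED1 S₁ ] ∑[ f ∈ nonEdges x ] isoCount (addEdge x f) G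
      ≡⟨ ∑ˡ-cong (λ G → ∑-concatMap-MD1 (λ M → isoCount M G) S₁) S₂ ⟨
    ∑[ G ∈ S₂ ] ∑[ M ∈ concatMap MD1 S₁ ] isoCount M G
      ≡⟨ ∑ˡ-cong (λ G → trans (∑ˡ-cong (λ M → isoCount≡𝟙*autCount M G) (concatMap MD1 S₁))
                               (∑ˡ-*ʳ (autCount G) (λ M → 𝟙 (M ≅? G)) (concatMap MD1 S₁))) S₂ ⟩
    ∑[ G ∈ S₂ ] (multiplicity G (concatMap MD1 S₁) * autCount G)
      ≡⟨ ∑ˡ-cong (λ G → trans (*-comm _ (autCount G))
                               (cong (autCount G *_) (sym (count≡multiplicity G (concatMap MD1 S₁))))) S₂ ⟩
    ∑[ G ∈ S₂ ] (autCount G * count G (concatMap MD1 S₁))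
      ∎
    where open ≡-Reasoning

  All-expand : ∀ {p} {Pr : Pred (Graph n) p} R S → All Pr R → All Pr (expand R S)
  All-expand R S all-R = concat⁺ (map⁺ (All.map (λ {K} Pr-K → replicate⁺ (count K S) Pr-K) all-R))

  MD1-count≡⇒ED1-count≡ : ∀ m (U V : List (Graph n)) → All (HasEdges m) U → All (HasEdges m) V →
    (∀ K → HasEdges m K → count K (concatMap MD1 U) ≡ count K (concatMap MD1 V)) →
    ∀ H → count H (concatMap ED1 U) ≡ count H (concatMap ED1 V)
  MD1-count≡⇒ED1-count≡ m U V U-m V-m MD1-agree H = begin
    count H (concatMap ED1 U)         ≡⟨ count≡multiplicity H (concatMap ED1 U) ⟩
    multiplicity H (concatMap ED1 U)  ≡⟨ diagonal≡cross⇒multiplicity≡ (concatMap ED1 U) (concatMap ED1 V) diagonal≡cross H ⟩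
    multiplicity H (concatMap ED1 V)  ≡⟨ count≡multiplicity H (concatMap ED1 V) ⟨
    count H (concatMap ED1 V)         ∎
    where
    open ≡-Reasoning
    ⟪U,-⟫≡⟪V,-⟫ : ∀ S → All (HasEdges m) S →
                  ⟪ concatMap ED1 U , concatMap ED1 S ⟫ ≡ ⟪ concatMap ED1 V , concatMap ED1 S ⟫
    ⟪U,-⟫≡⟪V,-⟫ S S-m = trans (⟪ED1,ED1⟫ U S)
      (trans (∑ˡ-cong-All (All.map (λ {K} K-m → cong (autCount K *_) (MD1-agree K K-m)) S-m)) (sym (⟪ED1,ED1⟫ V S)))
    diagonal≡cross : ⟪ concatMap ED1 U , concatMap ED1 U ⟫ + ⟪ concatMap ED1 V , concatMap ED1 V ⟫ ≡
                     ⟪ concatMap ED1 U , concatMap ED1 V ⟫ + ⟪ concatMap ED1 V , concatMap ED1 U ⟫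
    diagonal≡cross = trans (cong₂ _+_ (⟪U,-⟫≡⟪V,-⟫ U U-m) (sym (⟪U,-⟫≡⟪V,-⟫ V V-m)))
                           (+-comm ⟪ concatMap ED1 V , concatMap ED1 U ⟫ ⟪ concatMap ED1 U , concatMap ED1 V ⟫)

-- P and Q enter only through X_P and X_Q on R, whose members have m edges.
theorem2p6 : (n m : ℕ) → 1 ≤ n → m ≤ n C 2 →
    (P Q : List (Graph n)) → All (HasEdges m) P → All (HasEdges m) Q →
    (R : List (Graph n)) → ClassReps m R →
    (∀ H → HasEdges m H → (Δ1 · R at H) P ≡ (Δ1 · R at H) Q) →
    (∀ H → suc (edgeCount H) ≡ m → (d1 · R at H) P ≡ (d1 · R at H) Q)
theorem2p6 n m _ _ P Q _ _ R (R-m , _) Δ1-agree H _ = begin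
  (d1 · R at H) P                       ≡⟨ ·-at≡count-concatMap ED1 H R P ⟩
  count H (concatMap ED1 (expand R P))  ≡⟨ MD1-count≡⇒ED1-count≡ m (expand R P) (expand R Q)
                                             (All-expand R P R-m) (All-expand R Q R-m) MD1-agree H ⟩
  count H (concatMap ED1 (expand R Q))  ≡⟨ ·-at≡count-concatMap ED1 H R Q ⟨
  (d1 · R at H) Q                       ∎
  where
  open ≡-Reasoning
  MD1-agree : ∀ K → HasEdges m K → count K (concatMap MD1 (expand R P)) ≡ count K (concatMap MD1 (expand R Q))
  MD1-agree K K-m = trans (sym (·-at≡count-concatMap MD1 K R P)) (trans (Δ1-agree K K-m) (·-at≡count-concatMap MD1 K R Q))
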